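{- Let $(F_n)_{n\in\mathbb{N}}$ be a semiring family of graphs. Then for all $n,d,m\in\mathbb{N}_+$ there is a graph homomorphism $F_n/d\to F_{mn}/(md)$.
   Context: Graphs are undirected simple graphs, possibly infinite; $X\to Y$ denotes existence of a graph homomorphism. The join $G+H$ is the disjoint union with all edges between the two parts added; the disjunctive product $G\ast H$ has vertex set $V(G)\times V(H)$ with $(v,w)\sim(v',w')$ iff $v\sim v'$ or $w\sim w'$. A semiring family is a sequence of graphs $(F_n)_{n\in\mathbb{N}}$ with $F_0=\emptyset$, $F_1\ne\emptyset$, and $F_n+F_m\to F_{n+m}$, $F_n\ast F_m\to F_{nm}$ for all $n,m\in\mathbb{N}$. For $d\in\mathbb{N}_+$, $G/d$ is the graph whose vertices are the $d$-cliques of $G$, with $S\sim T$ iff $S\cap T=\emptyset$ and $s\sim t$ for all $s\in S,t\in T$. -}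

module Defs where

open import Data.Nat using (ℕ; zero; suc; _+_; _*_; NonZero)
open import Data.Fin using (Fin; zero; suc)
open import Data.Sum using (_⊎_; inj₁; inj₂)
open import Data.Product using (Σ; _×_; _,_; ∃; proj₁)
open import Data.Unit using (⊤)
open import Data.Empty using (⊥)
open import Relation.Nullary using (¬_)
open import Relation.Binary.PropositionalEquality using (_≡_; _≢_; refl; sym)

record Graph : Set₁ where
  field
    V     : Set
    _~_   : V → V → Set
    sym~  : ∀ {x y} → x ~ y → y ~ x
    irr~  : ∀ {x} → ¬ (x ~ x)
open Graph public

Hom : Graph → Graph → Set
Hom G H = Σ (V G → V H) λ f → ∀ {x y} → _~_ G x y → _~_ H (f x) (f y)

IsEmpty : Graph → Set
IsEmpty G = ¬ V G

NonEmpty : Graph → Set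
NonEmpty G = V G

join-adj : (G H : Graph) → V G ⊎ V H → V G ⊎ V H → Set
join-adj G H (inj₁ a) (inj₁ b) = _~_ G a b
join-adj G H (inj₁ a) (inj₂ b) = ⊤
join-adj G H (inj₂ a) (inj₁ b) = ⊤
join-adj G H (inj₂ a) (inj₂ b) = _~_ H a b

join-sym : (G H : Graph) → ∀ {x y} → join-adj G H x y → join-adj G H y x
join-sym G H {inj₁ a} {inj₁ b} p = sym~ G p
join-sym G H {inj₁ a} {inj₂ b} p = _
join-sym G H {inj₂ a} {inj₁ b} p = _
join-sym G H {inj₂ a} {inj₂ b} p = sym~ H p

join-irr : (G H : Graph) → ∀ {x} → ¬ join-adj G H x x
join-irr G H {inj₁ a} p = irr~ G p
join-irr G H {inj₂ a} p = irr~ H p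

_⊕_ : Graph → Graph → Graph
G ⊕ H = record { V = V G ⊎ V H ; _~_ = join-adj G H
               ; sym~ = λ {x} {y} → join-sym G H {x} {y} ; irr~ = λ {x} → join-irr G H {x} }

disj-adj : (G H : Graph) → V G × V H → V G × V H → Set
disj-adj G H (v , w) (v' , w') = _~_ G v v' ⊎ _~_ H w w'

disj-sym : (G H : Graph) → ∀ {x y} → disj-adj G H x y → disj-adj G H y x
disj-sym G H (inj₁ p) = inj₁ (sym~ G p)
disj-sym G H (inj₂ p) = inj₂ (sym~ H p)

disj-irr : (G H : Graph) → ∀ {x} → ¬ disj-adj G H x x
disj-irr G H (inj₁ p) = irr~ G p
disj-irr G H (inj₂ p) = irr~ H p

_⊛_ : Graph → Graph → Graph
G ⊛ H = record { V = V G × V H ; _~_ = disj-adj G H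
               ; sym~ = λ {x} {y} → disj-sym G H {x} {y} ; irr~ = λ {x} → disj-irr G H {x} }

record SemiringFamily (F : ℕ → Graph) : Set where
  field
    empty₀   : IsEmpty (F 0)
    nonempty₁ : NonEmpty (F 1)
    join-hom : ∀ n m → Hom (F n ⊕ F m) (F (n + m))
    prod-hom : ∀ n m → Hom (F n ⊛ F m) (F (n * m))

record Clique (G : Graph) (d : ℕ) : Set where
  constructor clique
  field
    elems : Fin d → V G
    inj   : ∀ {i j} → elems i ≡ elems j → i ≡ j
    adj   : ∀ {i j} → i ≢ j → _~_ G (elems i) (elems j)
open Clique public

quot-adj : (G : Graph) (d : ℕ) → Clique G d → Clique G d → Set
quot-adj G d S T =
  (∀ i j → elems S i ≢ elems T j) × (∀ i j → _~_ G (elems S i) (elems T j))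

quot-sym : (G : Graph) (d : ℕ) → ∀ {S T} → quot-adj G d S T → quot-adj G d T S
quot-sym G d (disj , a) = (λ i j e → disj j i (sym e))
                        , (λ i j → sym~ G (a j i))

quot-irr : (G : Graph) (d : ℕ) → .{{_ : NonZero d}} → ∀ {S} → ¬ quot-adj G d S S
quot-irr G (suc d) (disj , a) = disj zero zero refl

_/_ : (G : Graph) (d : ℕ) → .{{_ : NonZero d}} → Graph
G / d = record { V = Clique G d ; _~_ = quot-adj G d
               ; sym~ = λ {x} {y} → quot-sym G d {x} {y} ; irr~ = λ {x} → quot-irr G d {x} }

-- F m contains an m-clique, built from a vertex of F 1 by iterating
-- F 1 + F k → F (1 + k).  Blowing each vertex of a d-clique S of G up into an
-- m-clique gives the md-clique K m × S of K m ∗ G, and this blow-up preserves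
-- the adjacency of G / d.  Any homomorphism maps cliques injectively, so
-- K m ∗ F n → F m ∗ F n → F (m n) induces (K m ∗ F n) / md → F (m n) / md.
module Submission where

open import Defs
open import Data.Nat using (ℕ; zero; suc; _*_; NonZero)
open import Data.Nat.Properties using (m*n≢0)
open import Data.Fin using (Fin; zero; suc; remQuot; _≟_)
open import Data.Fin.Properties using (*↔×)
open import Data.Product using (_×_; _,_; proj₁; proj₂)
open import Data.Sum using (inj₁; inj₂)
open import Data.Empty using (⊥-elim)
open import Function using (_∘_; id)
open import Function.Bundles using (Injection)
open import Function.Properties.Inverse using (↔⇒↣)
open import Relation.Nullary using (yes; no)
open import Relation.Binary.PropositionalEquality using (_≡_; _≢_; refl; sym; cong)

~⇒≢ : (G : Graph) → ∀ {x y} → _~_ G x y → x ≢ y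
~⇒≢ G {x} x~y refl = irr~ G x~y

Hom-refl : (G : Graph) → Hom G G
Hom-refl G = id , id

Hom-trans : ∀ {G H I} → Hom G H → Hom H I → Hom G I
Hom-trans (f , f-hom) (g , g-hom) = g ∘ f , g-hom ∘ f-hom

Hom-⊛ : ∀ {G G′ H H′} → Hom G G′ → Hom H H′ → Hom (G ⊛ H) (G′ ⊛ H′)
Hom-⊛ (f , f-hom) (g , g-hom) = (λ (v , w) → f v , g w) , λ where
  (inj₁ v~v′) → inj₁ (f-hom v~v′)
  (inj₂ w~w′) → inj₂ (g-hom w~w′)

K : ℕ → Graph
K m = record { V = Fin m ; _~_ = _≢_ ; sym~ = λ i≢j → i≢j ∘ sym
             ; irr~ = λ i≢i → i≢i refl }

-- Injectivity is automatic: distinct indices give adjacent, hence distinct, vertices.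
pairwise-adjacent⇒clique : ∀ {G d} (f : Fin d → V G) →
                           (∀ {i j} → i ≢ j → _~_ G (f i) (f j)) → Clique G d
pairwise-adjacent⇒clique {G} f f-adj = clique f injective f-adj
  where
  injective : ∀ {i j} → f i ≡ f j → i ≡ j
  injective {i} {j} fi≡fj with i ≟ j
  ... | yes i≡j = i≡j
  ... | no  i≢j = ⊥-elim (~⇒≢ G (f-adj i≢j) fi≡fj)

Hom-/ : ∀ {G H} d .{{_ : NonZero d}} → Hom G H → Hom (G / d) (H / d)
Hom-/ {H = H} d (f , f-hom) = image , λ (_ , S~T) →
  (λ i j → ~⇒≢ H (f-hom (S~T i j))) , (λ i j → f-hom (S~T i j))
  where
  image : Clique _ d → Clique H d
  image S = pairwise-adjacent⇒clique (f ∘ elems S) (f-hom ∘ adj S)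

module _ {G : Graph} (m d : ℕ) where

  blowup : Clique G d → Fin m × Fin d → V (K m ⊛ G)
  blowup S (a , i) = a , elems S i

  blowup-adj : (S : Clique G d) → ∀ {p q} → p ≢ q → _~_ (K m ⊛ G) (blowup S p) (blowup S q)
  blowup-adj S {a , i} {b , j} p≢q with a ≟ b | i ≟ j
  ... | no  a≢b  | _        = inj₁ a≢b
  ... | yes _    | no  i≢j  = inj₂ (adj S i≢j)
  ... | yes refl | yes refl = ⊥-elim (p≢q refl)

  blowup-clique : Clique G d → Clique (K m ⊛ G) (m * d)
  blowup-clique S = pairwise-adjacent⇒clique (blowup S ∘ remQuot d)
    (λ k≢l → blowup-adj S (k≢l ∘ Injection.injective (↔⇒↣ (*↔× {m} {d}))))

  Hom-/-blowup : .{{_ : NonZero m}} → .{{_ : NonZero d}} →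
                 Hom (G / d) (_/_ (K m ⊛ G) (m * d) {{m*n≢0 m d}})
  Hom-/-blowup = blowup-clique , λ (_ , S~T) →
    (λ _ _ → ~⇒≢ (K m ⊛ G) (inj₂ (S~T _ _))) , (λ _ _ → inj₂ (S~T _ _))

module _ {F : ℕ → Graph} (SF : SemiringFamily F) where
  open SemiringFamily SF

  K→F : ∀ m → Hom (K m) (F m)
  K→F m = vertex m , vertex-adj m
    where
    vertex : ∀ k → Fin k → V (F k)
    vertex (suc k) zero    = proj₁ (join-hom 1 k) (inj₁ nonempty₁)
    vertex (suc k) (suc i) = proj₁ (join-hom 1 k) (inj₂ (vertex k i))

    vertex-adj : ∀ k {i j} → i ≢ j → _~_ (F k) (vertex k i) (vertex k j)
    vertex-adj (suc k) {zero}  {zero}  0≢0 = ⊥-elim (0≢0 refl)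
    vertex-adj (suc k) {zero}  {suc j} _   = proj₂ (join-hom 1 k) _
    vertex-adj (suc k) {suc i} {zero}  _   = proj₂ (join-hom 1 k) _
    vertex-adj (suc k) {suc i} {suc j} i≢j = proj₂ (join-hom 1 k) (vertex-adj k (i≢j ∘ cong suc))

lemma4p2 : (F : ℕ → Graph) → SemiringFamily F →
    (n d m : ℕ) → .{{_ : NonZero n}} → .{{_ : NonZero d}} → .{{_ : NonZero m}} →
    Hom (F n / d) (_/_ (F (m * n)) (m * d) {{m*n≢0 m d}})
lemma4p2 F SF n d m =
  Hom-trans {F n / d} {Blowup} {F (m * n) / (m * d)} (Hom-/-blowup m d) (Hom-/ (m * d) K⊛Fₙ→Fₘₙ)
  where
  instance
    md≢0 : NonZero (m * d)
    md≢0 = m*n≢0 m d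

  Blowup : Graph
  Blowup = (K m ⊛ F n) / (m * d)

  K⊛Fₙ→Fₘₙ : Hom (K m ⊛ F n) (F (m * n))
  K⊛Fₙ→Fₘₙ = Hom-trans {K m ⊛ F n} {F m ⊛ F n} {F (m * n)}
    (Hom-⊛ {K m} {F m} {F n} {F n} (K→F SF m) (Hom-refl (F n))) (SemiringFamily.prod-hom SF m n)
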